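{- Let $n\ge3$ and $k\ge0$ be integers. There exists a set of vertices of $G_n^k$ which is independent in $G_n^k$ but not reversible if and only if $n\le 2k$.
   Context: The crown $S_n^k$ is the height-2 poset on $A\cup B$, $A=\{a_1,\dots,a_{n+k}\}$ minimal elements, $B=\{b_1,\dots,b_{n+k}\}$ maximal elements, indices cyclic mod $n+k$; $a_i$ is incomparable to $b_j$ iff $j\in\{i,\dots,i+k\}$ (mod $n+k$), otherwise $a_i<b_j$. $\mathrm{Inc}(A,B)$ is the set of incomparable pairs $(a,b)\in A\times B$. $G_n^k$ is the graph on $\mathrm{Inc}(A,B)$ with $(a,b)\sim(x,y)$ iff $a<y$ and $x<b$. A set $S\subseteq\mathrm{Inc}(A,B)$ is reversible if there is a linear extension $L$ of $S_n^k$ with $x>y$ in $L$ for all $(x,y)\in S$. -}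

module Defs where

open import Data.Nat using (ℕ; _+_; _∸_; _≤_; _<_; _≤ᵇ_)
open import Data.Bool using (if_then_else_)
open import Data.Fin using (Fin; toℕ)
open import Data.Sum using (_⊎_; inj₁; inj₂)
open import Data.Product using (_×_; Σ; ∃; _,_)
open import Relation.Nullary using (¬_)
open import Data.Empty renaming (⊥ to Empty)
open import Function.Definitions using (Injective)
open import Relation.Binary.PropositionalEquality using (_≡_)

-- Crown S_n^k with N = n + k elements on each side.
-- Indices of a_i, b_j are Fin (n + k), read cyclically mod (n + k).

-- cyclic difference (j - i) mod N, for i, j < N, computed without division
cdiff : (N : ℕ) → Fin N → Fin N → ℕ
cdiff N i j = if toℕ i ≤ᵇ toℕ j then toℕ j ∸ toℕ i else (N + toℕ j) ∸ toℕ i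

-- a_i incomparable to b_j  iff  j ∈ {i, …, i+k} (mod n+k)
Inc : (n k : ℕ) → Fin (n + k) → Fin (n + k) → Set
Inc n k i j = cdiff (n + k) i j ≤ k

Lt : (n k : ℕ) → Fin (n + k) → Fin (n + k) → Set
Lt n k i j = ¬ Inc n k i j

-- elements of the crown: inj₁ i = a_i (minimal), inj₂ j = b_j (maximal)
Elem : ℕ → ℕ → Set
Elem n k = Fin (n + k) ⊎ Fin (n + k)

CrownLt : (n k : ℕ) → Elem n k → Elem n k → Set
CrownLt n k (inj₁ i) (inj₂ j) = Lt n k i j
CrownLt n k _ _ = Empty

-- a linear extension of the crown, given as an injective ranking into ℕ
-- (any finite linear order is realised this way) that respects the order
record LinExt (n k : ℕ) : Set where
  field
    rank : Elem n k → ℕ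
    rank-inj : Injective _≡_ _≡_ rank
    rank-mono : ∀ x y → CrownLt n k x y → rank x < rank y

-- vertices of G_n^k are the pairs (a_i, b_j) in Inc(A,B); a set of vertices
-- is a predicate S on index pairs, contained in Inc(A,B)
VertexSet : (n k : ℕ) → Set₁
VertexSet n k = Fin (n + k) → Fin (n + k) → Set

IsVertexSet : (n k : ℕ) → VertexSet n k → Set
IsVertexSet n k S = ∀ i j → S i j → Inc n k i j

Adj : (n k : ℕ) → Fin (n + k) → Fin (n + k) → Fin (n + k) → Fin (n + k) → Set
Adj n k i j x y = Lt n k i y × Lt n k x j

Independent : (n k : ℕ) → VertexSet n k → Set
Independent n k S = ∀ i j x y → S i j → S x y → ¬ Adj n k i j x y

Reversible : (n k : ℕ) → VertexSet n k → Set
Reversible n k S = Σ (LinExt n k) λ L →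
  ∀ i j → S i j → LinExt.rank L (inj₂ j) < LinExt.rank L (inj₁ i)

module Submission where

-- If n ≤ 2k, pick h with 1 ≤ h ≤ k, h < n ≤ h + k. The pairs (a₀, b_h), (a_h, b_{h+k}), (a_n, b₀)
-- are incomparable and pairwise non-adjacent in G_n^k, yet a₀ < b_{h+k}, a_h < b₀, a_n < b_h, so a
-- linear extension reversing them would contain the cycle b_h < a₀ < b_{h+k} < a_h < b₀ < a_n < b_h.
--
-- If 2k < n, let S be independent and measure positions cyclically from the point 2k before the
-- top of some pair of S. Independence puts every pair (a_x, b_y) of S inside the positions [0, 3k],
-- with p x ≤ p y ≤ p x + k; as 3k < n + k, a_x < b_y then means that b_y lies beyond p x + k or
-- before p x. Let the spread of b_y be the largest distance from b_y to the top of a pair of S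
-- whose bottom lies below b_y. Independence makes the spread strictly increase from b_y to b_y′
-- whenever (a_x, b_y), (a_x′, b_y′) ∈ S and a_x < b_y′, and sorting by spread reverses S.

open import Defs
open import Data.Nat using (ℕ; _≤_; _*_)
open import Data.Product using (Σ; _×_)
open import Relation.Nullary using (¬_)
open import Function.Bundles using (_⇔_)

open import Data.Bool using (true; false)
open import Data.Empty using (⊥-elim)
open import Data.Fin as Fin using (Fin; toℕ; fromℕ<; join; splitAt)
open import Data.Fin.Properties using (toℕ<n; toℕ-injective; toℕ-fromℕ<; splitAt-join; toℕ-↑ˡ; toℕ-↑ʳ; any?; sequence)
open import Data.List using (_∷_; [])
open import Data.Nat using (zero; suc; _+_; _∸_; _<_; _⊔_; _≤ᵇ_; _≤?_; _<?_; ∣_-_∣; z≤n; s≤s; s≤s⁻¹; NonZero; >-nonZero)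
open import Data.Nat.Properties
open import Data.Nat.DivMod using (_%_; [m+kn]%n≡m%n; m<n⇒m%n≡m)
open import Data.Nat.Tactic.RingSolver using (solve)
open import Data.Product using (∃; _,_; proj₁; proj₂)
open import Data.Sum using (_⊎_; inj₁; inj₂)
open import Effect.Monad using (RawMonad)
open import Function.Base using (_∘_)
open import Function.Bundles using (mk⇔)
open import Relation.Nullary using (Dec; yes; no; ofʸ; ofⁿ; ¬?; _×-dec_; ¬¬-excluded-middle)
open import Relation.Nullary.Negation using (¬¬-Monad)
open import Relation.Unary using (Pred; Decidable)
open import Level using (0ℓ)
open import Relation.Binary.PropositionalEquality

cdiff-cases : ∀ N (a b : Fin N) →
  (toℕ a ≤ toℕ b × cdiff N a b ≡ toℕ b ∸ toℕ a) ⊎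
  (toℕ b < toℕ a × cdiff N a b ≡ N + toℕ b ∸ toℕ a)
cdiff-cases N a b with toℕ a ≤ᵇ toℕ b | ≤ᵇ-reflects-≤ (toℕ a) (toℕ b)
... | true  | ofʸ a≤b = inj₁ (a≤b , refl)
... | false | ofⁿ a≰b = inj₂ (≰⇒> a≰b , refl)

cdiff<N : ∀ N (a b : Fin N) → cdiff N a b < N
cdiff<N N a b with cdiff-cases N a b
... | inj₁ (_ , eq) rewrite eq = ≤-<-trans (m∸n≤m (toℕ b) (toℕ a)) (toℕ<n b)
... | inj₂ (b<a , eq) rewrite eq = begin-strict
  N + toℕ b ∸ toℕ a <⟨ ∸-monoʳ-< b<a (≤-trans (<⇒≤ (toℕ<n a)) (m≤m+n N (toℕ b))) ⟩
  N + toℕ b ∸ toℕ b ≡⟨ m+n∸n≡m N (toℕ b) ⟩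
  N                 ∎
  where open ≤-Reasoning

Wrap : ℕ → ℕ → Set
Wrap N e = e ≡ 0 ⊎ e ≡ N

cdiff-wraps : ∀ N (a b : Fin N) → ∃ λ e → Wrap N e × toℕ a + cdiff N a b ≡ toℕ b + e
cdiff-wraps N a b with cdiff-cases N a b
... | inj₁ (a≤b , eq) rewrite eq = 0 , inj₁ refl , trans (m+[n∸m]≡n a≤b) (sym (+-identityʳ _))
... | inj₂ (b<a , eq) rewrite eq = N , inj₂ refl , trans
  (m+[n∸m]≡n (≤-trans (<⇒≤ (toℕ<n a)) (m≤m+n N (toℕ b)))) (+-comm N (toℕ b))

wraps-cancel : ∀ c x y u v w e₁ e₂ e₃ → c + u ≡ x + e₁ → x + v ≡ y + e₂ → c + w ≡ y + e₃ →
  (u + v) + e₃ ≡ w + (e₁ + e₂)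
wraps-cancel c x y u v w e₁ e₂ e₃ h₁ h₂ h₃ = +-cancelˡ-≡ (c + x) _ _ (begin
  (c + x) + ((u + v) + e₃)  ≡⟨ solve (c ∷ x ∷ u ∷ v ∷ e₃ ∷ []) ⟩
  (c + u) + (x + v) + e₃    ≡⟨ cong₂ (λ s t → s + t + e₃) h₁ h₂ ⟩
  (x + e₁) + (y + e₂) + e₃  ≡⟨ solve (x ∷ y ∷ e₁ ∷ e₂ ∷ e₃ ∷ []) ⟩
  x + (y + e₃) + (e₁ + e₂)  ≡⟨ cong (λ s → x + s + (e₁ + e₂)) (sym h₃) ⟩
  x + (c + w) + (e₁ + e₂)   ≡⟨ solve (c ∷ x ∷ w ∷ e₁ ∷ e₂ ∷ []) ⟩
  (c + x) + (w + (e₁ + e₂)) ∎)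
  where open ≡-Reasoning

sum-of-residues : ∀ {N u v w e₁ e₂ e₃} → u < N → v < N → w < N →
  Wrap N e₁ → Wrap N e₂ → Wrap N e₃ → (u + v) + e₃ ≡ w + (e₁ + e₂) →
  u + v ≡ w ⊎ u + v ≡ w + N
sum-of-residues {N} {u} {v} {w} u<N v<N w<N = cases
  where
  cases : ∀ {e₁ e₂ e₃} → Wrap N e₁ → Wrap N e₂ → Wrap N e₃ →
    (u + v) + e₃ ≡ w + (e₁ + e₂) → u + v ≡ w ⊎ u + v ≡ w + N
  cases (inj₁ refl) (inj₁ refl) (inj₁ refl) eq = inj₁ (+-cancelʳ-≡ 0 _ _ eq)
  cases (inj₁ refl) (inj₁ refl) (inj₂ refl) eq =
    ⊥-elim (<⇒≱ w<N (subst (N ≤_) (trans eq (+-identityʳ w)) (m≤n+m N (u + v))))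
  cases (inj₁ refl) (inj₂ refl) (inj₁ refl) eq = inj₂ (trans (sym (+-identityʳ _)) eq)
  cases (inj₂ refl) (inj₁ refl) (inj₁ refl) eq =
    inj₂ (trans (sym (+-identityʳ _)) (trans eq (cong (w +_) (+-identityʳ N))))
  cases (inj₁ refl) (inj₂ refl) (inj₂ refl) eq = inj₁ (+-cancelʳ-≡ N _ _ eq)
  cases (inj₂ refl) (inj₁ refl) (inj₂ refl) eq =
    inj₁ (+-cancelʳ-≡ N _ _ (trans eq (cong (w +_) (+-identityʳ N))))
  cases (inj₂ refl) (inj₂ refl) (inj₁ refl) eq =
    ⊥-elim (<⇒≱ (+-mono-< u<N v<N) (subst (N + N ≤_)
      (sym (trans (sym (+-identityʳ _)) eq)) (m≤n+m (N + N) w)))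
  cases (inj₂ refl) (inj₂ refl) (inj₂ refl) eq = inj₂ (+-cancelʳ-≡ N _ _ (trans eq (sym (+-assoc w N N))))

cdiff-triangle : ∀ N (c x y : Fin N) →
  cdiff N c x + cdiff N x y ≡ cdiff N c y ⊎ cdiff N c x + cdiff N x y ≡ cdiff N c y + N
cdiff-triangle N c x y with cdiff-wraps N c x | cdiff-wraps N x y | cdiff-wraps N c y
... | e₁ , w₁ , h₁ | e₂ , w₂ , h₂ | e₃ , w₃ , h₃ =
  sum-of-residues (cdiff<N N c x) (cdiff<N N x y) (cdiff<N N c y) w₁ w₂ w₃
    (wraps-cancel (toℕ c) (toℕ x) (toℕ y) _ _ _ e₁ e₂ e₃ h₁ h₂ h₃)

cdiff-surjective : ∀ N (b : Fin N) t → t < N → ∃ λ a → cdiff N a b ≡ t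
cdiff-surjective N b t t<N with t ≤? toℕ b
... | yes t≤b = a , value (cdiff-cases N a b)
  where
  a = fromℕ< (≤-<-trans (m∸n≤m (toℕ b) t) (toℕ<n b))
  a≡ : toℕ a ≡ toℕ b ∸ t
  a≡ = toℕ-fromℕ< _
  value : _ → cdiff N a b ≡ t
  value (inj₁ (_ , eq)) = trans eq (trans (cong (toℕ b ∸_) a≡) (m∸[m∸n]≡n t≤b))
  value (inj₂ (b<a , _)) = ⊥-elim (<⇒≱ b<a (subst (_≤ toℕ b) (sym a≡) (m∸n≤m (toℕ b) t)))
... | no t≰b = a , value (cdiff-cases N a b)
  where
  b<t = ≰⇒> t≰b
  t≤b+N : t ≤ toℕ b + N
  t≤b+N = ≤-trans (<⇒≤ t<N) (m≤n+m N (toℕ b))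
  a<N : toℕ b + N ∸ t < N
  a<N = +-cancelʳ-< t _ _ (subst (_< N + t) (sym (m∸n+n≡m t≤b+N))
          (subst (toℕ b + N <_) (+-comm t N) (+-monoˡ-< N b<t)))
  a = fromℕ< a<N
  a≡ : toℕ a ≡ toℕ b + N ∸ t
  a≡ = toℕ-fromℕ< a<N
  value : _ → cdiff N a b ≡ t
  value (inj₁ (a≤b , _)) = ⊥-elim (<⇒≱ (subst (toℕ b <_) (sym a≡) b<a) a≤b)
    where
    b<a : toℕ b < toℕ b + N ∸ t
    b<a = +-cancelʳ-< t _ _ (subst (toℕ b + t <_) (sym (m∸n+n≡m t≤b+N)) (+-monoʳ-< (toℕ b) t<N))
  value (inj₂ (_ , eq)) = trans eq (trans (cong₂ _∸_ (+-comm N (toℕ b)) a≡) (m∸[m∸n]≡n t≤b+N))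

cdiff-self : ∀ N (a : Fin N) → cdiff N a a ≡ 0
cdiff-self N a with cdiff-cases N a a
... | inj₁ (_ , eq) = trans eq (n∸n≡0 (toℕ a))
... | inj₂ (a<a , _) = ⊥-elim (<-irrefl refl a<a)

cdiff-fromℕ<-≤ : ∀ {N a b} (a<N : a < N) (b<N : b < N) → a ≤ b →
  cdiff N (fromℕ< a<N) (fromℕ< b<N) ≡ b ∸ a
cdiff-fromℕ<-≤ {N} a<N b<N a≤b with cdiff-cases N (fromℕ< a<N) (fromℕ< b<N)
... | inj₁ (_ , eq) = trans eq (cong₂ _∸_ (toℕ-fromℕ< b<N) (toℕ-fromℕ< a<N))
... | inj₂ (b<a , _) = ⊥-elim (<⇒≱ (subst₂ _<_ (toℕ-fromℕ< b<N) (toℕ-fromℕ< a<N) b<a) a≤b)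

cdiff-fromℕ<-> : ∀ {N a b} (a<N : a < N) (b<N : b < N) → b < a →
  cdiff N (fromℕ< a<N) (fromℕ< b<N) ≡ N + b ∸ a
cdiff-fromℕ<-> {N} a<N b<N b<a with cdiff-cases N (fromℕ< a<N) (fromℕ< b<N)
... | inj₁ (a≤b , _) = ⊥-elim (<⇒≱ b<a (subst₂ _≤_ (toℕ-fromℕ< a<N) (toℕ-fromℕ< b<N) a≤b))
... | inj₂ (_ , eq) = trans eq (cong₂ (λ s t → N + s ∸ t) (toℕ-fromℕ< b<N) (toℕ-fromℕ< a<N))

sup : ∀ {m} {P : Pred (Fin m) 0ℓ} → Decidable P → (Fin m → ℕ) → ℕ
sup {zero}  P? f = 0
sup {suc m} P? f with P? Fin.zero
... | yes _ = f Fin.zero ⊔ sup (P? ∘ Fin.suc) (f ∘ Fin.suc)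
... | no  _ = sup (P? ∘ Fin.suc) (f ∘ Fin.suc)

sup-upper : ∀ {m} {P : Pred (Fin m) 0ℓ} (P? : Decidable P) (f : Fin m → ℕ) {i} → P i → f i ≤ sup P? f
sup-upper {suc m} P? f {i} p with P? Fin.zero | i
... | yes _  | Fin.zero  = m≤m⊔n _ _
... | yes _  | Fin.suc i = ≤-trans (sup-upper (P? ∘ Fin.suc) (f ∘ Fin.suc) p) (m≤n⊔m _ _)
... | no ¬p₀ | Fin.zero  = ⊥-elim (¬p₀ p)
... | no _   | Fin.suc i = sup-upper (P? ∘ Fin.suc) (f ∘ Fin.suc) p

sup-≤ : ∀ {m} {P : Pred (Fin m) 0ℓ} (P? : Decidable P) (f : Fin m → ℕ) {B} →
  (∀ i → P i → f i ≤ B) → sup P? f ≤ B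
sup-≤ {zero}  P? f h = z≤n
sup-≤ {suc m} P? f h with P? Fin.zero
... | yes p₀ = ⊔-lub (h Fin.zero p₀) (sup-≤ (P? ∘ Fin.suc) (f ∘ Fin.suc) (h ∘ Fin.suc))
... | no _   = sup-≤ (P? ∘ Fin.suc) (f ∘ Fin.suc) (h ∘ Fin.suc)

sup-< : ∀ {m} {P : Pred (Fin m) 0ℓ} (P? : Decidable P) (f : Fin m → ℕ) {B} → 0 < B →
  (∀ i → P i → f i < B) → sup P? f < B
sup-< P? f {suc B} _ h = s≤s (sup-≤ P? f (λ i p → s≤s⁻¹ (h i p)))

¬¬-decidable₂ : ∀ {m} (R : Fin m → Fin m → Set) → ¬ ¬ (∀ i j → Dec (R i j))
¬¬-decidable₂ R = sequence rawApplicative (λ i → sequence rawApplicative (λ j → ¬¬-excluded-middle))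
  where open RawMonad (¬¬-Monad {0ℓ}) using (rawApplicative)

module _ {n k : ℕ} where

  private
    N = n + k

  code : Elem n k → ℕ
  code = toℕ ∘ join N N

  code-injective : ∀ {u v} → code u ≡ code v → u ≡ v
  code-injective {u} {v} eq = begin
    u                        ≡⟨ sym (splitAt-join N N u) ⟩
    splitAt N (join N N u)   ≡⟨ cong (splitAt N) (toℕ-injective eq) ⟩
    splitAt N (join N N v)   ≡⟨ splitAt-join N N v ⟩
    v                        ∎
    where open ≡-Reasoning

  -- Ranks sort by key first; the code breaks ties, placing every a_i before every b_j.
  keyed-rank : (Elem n k → ℕ) → Elem n k → ℕ
  keyed-rank key e = code e + key e * (N + N)

  keyed-rank-< : ∀ key u v → key u < key v → keyed-rank key u < keyed-rank key v
  keyed-rank-< key u v lt = begin-strict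
    code u + key u * (N + N) <⟨ +-monoˡ-< (key u * (N + N)) (toℕ<n (join N N u)) ⟩
    suc (key u) * (N + N)    ≤⟨ *-monoˡ-≤ (N + N) lt ⟩
    key v * (N + N)          ≤⟨ m≤n+m _ (code v) ⟩
    code v + key v * (N + N) ∎
    where open ≤-Reasoning

  keyed-rank-injective : ∀ key {u v} → keyed-rank key u ≡ keyed-rank key v → u ≡ v
  keyed-rank-injective key {u} {v} eq = code-injective (begin
    code u                       ≡⟨ sym (m<n⇒m%n≡m (toℕ<n (join N N u))) ⟩
    code u % (N + N)             ≡⟨ sym ([m+kn]%n≡m%n (code u) (key u) (N + N)) ⟩
    keyed-rank key u % (N + N)   ≡⟨ cong (_% (N + N)) eq ⟩
    keyed-rank key v % (N + N)   ≡⟨ [m+kn]%n≡m%n (code v) (key v) (N + N) ⟩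
    code v % (N + N)             ≡⟨ m<n⇒m%n≡m (toℕ<n (join N N v)) ⟩
    code v                       ∎)
    where
    open ≡-Reasoning
    instance
      _ : NonZero (N + N)
      _ = >-nonZero (≤-<-trans z≤n (toℕ<n (join N N u)))

  linExt-fromKey : (key : Elem n k → ℕ) →
    (∀ x y → Lt n k x y → key (inj₁ x) ≤ key (inj₂ y)) → LinExt n k
  linExt-fromKey key mono = record
    { rank     = keyed-rank key
    ; rank-inj = keyed-rank-injective key
    ; rank-mono = rank-mono }
    where
    rank-mono : ∀ u v → CrownLt n k u v → keyed-rank key u < keyed-rank key v
    rank-mono (inj₁ x) (inj₂ y) lt = +-mono-<-≤ code< (*-monoˡ-≤ (N + N) (mono x y lt))
      where
      code< : code (inj₁ x) < code (inj₂ y)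
      code< = begin-strict
        toℕ (x Fin.↑ˡ N) ≡⟨ toℕ-↑ˡ x N ⟩
        toℕ x            <⟨ toℕ<n x ⟩
        N                ≤⟨ m≤m+n N (toℕ y) ⟩
        N + toℕ y        ≡⟨ sym (toℕ-↑ʳ N y) ⟩
        toℕ (N Fin.↑ʳ y) ∎
        where open ≤-Reasoning

-- b_y is keyed by φ y, a_x just above every φ y with (a_x, b_y) ∈ S, and the b's outside S on top.
reversible-if-ranked : ∀ {n k} (S : VertexSet n k) → (∀ i j → Dec (S i j)) → (φ : Fin (n + k) → ℕ) →
  (∀ x y x′ y′ → S x y → S x′ y′ → Lt n k x y′ → φ y < φ y′) → Reversible n k S
reversible-if-ranked {n} {k} S S? φ ranked = linExt-fromKey {n} {k} key mono , reversed
  where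
  Top : Pred (Fin (n + k)) 0ℓ
  Top y = ∃ λ i → S i y

  top? : Decidable Top
  top? y = any? (λ i → S? i y)

  ceiling : ℕ
  ceiling = sup top? (suc ∘ φ)

  topKey : ∀ y → Dec (Top y) → ℕ
  topKey y (yes _) = φ y
  topKey y (no _)  = ceiling

  key : Elem n k → ℕ
  key (inj₁ x) = sup (S? x) (suc ∘ φ)
  key (inj₂ y) = topKey y (top? y)

  below-topKey : ∀ x y j → S x j → Lt n k x y → (d : Dec (Top y)) → φ j < topKey y d
  below-topKey x y j sxj lt (yes (i , siy)) = ranked x j i y sxj siy lt
  below-topKey x y j sxj lt (no _)          = sup-upper top? (suc ∘ φ) (x , sxj)

  mono : ∀ x y → Lt n k x y → key (inj₁ x) ≤ key (inj₂ y)
  mono x y lt = sup-≤ (S? x) (suc ∘ φ) (λ j sxj → below-topKey x y j sxj lt (top? y))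

  topKey-< : ∀ x y → S x y → (d : Dec (Top y)) → topKey y d < key (inj₁ x)
  topKey-< x y sxy (yes _) = sup-upper (S? x) (suc ∘ φ) sxy
  topKey-< x y sxy (no ¬top) = ⊥-elim (¬top (x , sxy))

  reversed : ∀ i j → S i j → keyed-rank {n} {k} key (inj₂ j) < keyed-rank {n} {k} key (inj₁ i)
  reversed i j sij = keyed-rank-< {n} {k} key (inj₂ j) (inj₁ i) (topKey-< i j sij (top? j))

∣-∣-<-farther : ∀ {a b c} → a ≤ b → b < c → ∣ b - a ∣ < ∣ c - a ∣
∣-∣-<-farther {a} {b} {c} a≤b b<c = begin-strict
  ∣ b - a ∣ ≡⟨ m≤n⇒∣n-m∣≡n∸m a≤b ⟩
  b ∸ a     <⟨ ∸-monoˡ-< b<c a≤b ⟩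
  c ∸ a     ≡⟨ sym (m≤n⇒∣n-m∣≡n∸m (≤-trans a≤b (<⇒≤ b<c))) ⟩
  ∣ c - a ∣ ∎
  where open ≤-Reasoning

∣-∣-<-farther′ : ∀ {a b c} → c < b → b ≤ a → ∣ b - a ∣ < ∣ c - a ∣
∣-∣-<-farther′ {a} {b} {c} c<b b≤a = begin-strict
  ∣ b - a ∣ ≡⟨ m≤n⇒∣m-n∣≡n∸m b≤a ⟩
  a ∸ b     <⟨ ∸-monoʳ-< c<b b≤a ⟩
  a ∸ c     ≡⟨ sym (m≤n⇒∣m-n∣≡n∸m (≤-trans (<⇒≤ c<b) b≤a)) ⟩
  ∣ c - a ∣ ∎
  where open ≤-Reasoning

-- Cutting the cycle at c: p x is the position of x counted cyclically from c.
module Positions (n k : ℕ) (c : Fin (n + k)) where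

  N = n + k

  p : Fin N → ℕ
  p = cdiff N c

  Lt? : ∀ i y → Dec (Lt n k i y)
  Lt? i y = ¬? (cdiff N i y ≤? k)

  inc⇒no-wrap : ∀ x y → Inc n k x y → k ≤ p y → p x + cdiff N x y ≡ p y
  inc⇒no-wrap x y inc k≤y with cdiff-triangle N c x y
  ... | inj₁ eq = eq
  ... | inj₂ eq = ⊥-elim (<-irrefl eq (begin-strict
    p x + cdiff N x y ≤⟨ +-monoʳ-≤ (p x) inc ⟩
    p x + k           <⟨ +-monoˡ-< k (cdiff<N N c x) ⟩
    N + k             ≤⟨ +-monoʳ-≤ N k≤y ⟩
    N + p y           ≡⟨ +-comm N (p y) ⟩
    p y + N           ∎))
    where open ≤-Reasoning

  lt⇒right⊎left : ∀ x y → Lt n k x y → p x + k < p y ⊎ p y < p x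
  lt⇒right⊎left x y lt with cdiff-triangle N c x y
  ... | inj₁ eq = inj₁ (subst (p x + k <_) eq (+-monoʳ-< (p x) (≰⇒> lt)))
  ... | inj₂ eq = inj₂ (+-cancelʳ-< N (p y) (p x)
                   (subst (_< p x + N) eq (+-monoʳ-< (p x) (cdiff<N N x y))))

  right⇒lt : ∀ x y → p x + k < p y → Lt n k x y
  right⇒lt x y right inc with cdiff-triangle N c x y
  ... | inj₁ eq = <⇒≱ right (subst (_≤ p x + k) eq (+-monoʳ-≤ (p x) inc))
  ... | inj₂ eq = <-irrefl eq (<-≤-trans (≤-<-trans (+-monoʳ-≤ (p x) inc) right) (m≤m+n (p y) N))

  left⇒lt : ∀ x y → p y < p x → p x + k < p y + N → Lt n k x y
  left⇒lt x y left near inc with cdiff-triangle N c x y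
  ... | inj₁ eq = <⇒≱ left (subst (p x ≤_) eq (m≤m+n (p x) (cdiff N x y)))
  ... | inj₂ eq = <-irrefl eq (≤-<-trans (+-monoʳ-≤ (p x) inc) near)

module IndependentSet {n k : ℕ} (3k<N : k + k + k < n + k)
  (S : VertexSet n k) (S? : ∀ i j → Dec (S i j)) (vs : IsVertexSet n k S) (ind : Independent n k S)
  {x₀ y₀ : Fin (n + k)} (s₀ : S x₀ y₀) (c : Fin (n + k)) (c-y₀ : cdiff (n + k) c y₀ ≡ k + k) where

  open Positions n k c

  top-in-window-via : ∀ z y → Inc n k z y₀ → Inc n k z y → k ≤ p y × p y ≤ k + k + k
  top-in-window-via z y z-y₀ z-y = window (cdiff-triangle N c z y)
    where
    z-to-y₀ : p z + cdiff N z y₀ ≡ k + k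
    z-to-y₀ = trans (inc⇒no-wrap z y₀ z-y₀ (subst (k ≤_) (sym c-y₀) (m≤m+n k k))) c-y₀
    k≤z : k ≤ p z
    k≤z = +-cancelʳ-≤ k k (p z) (subst (_≤ p z + k) z-to-y₀ (+-monoʳ-≤ (p z) z-y₀))
    z+d≤3k : p z + cdiff N z y ≤ k + k + k
    z+d≤3k = +-mono-≤ (subst (p z ≤_) z-to-y₀ (m≤m+n (p z) _)) z-y
    window : p z + cdiff N z y ≡ p y ⊎ p z + cdiff N z y ≡ p y + N → k ≤ p y × p y ≤ k + k + k
    window (inj₁ eq) = ≤-trans k≤z (subst (p z ≤_) eq (m≤m+n (p z) _)) , subst (_≤ k + k + k) eq z+d≤3k
    window (inj₂ eq) = ⊥-elim (<-irrefl eq (≤-<-trans z+d≤3k (<-≤-trans 3k<N (m≤n+m N (p y)))))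

  top-in-window : ∀ {x y} → S x y → k ≤ p y × p y ≤ k + k + k
  top-in-window {x} {y} sxy with cdiff N x₀ y ≤? k | cdiff N x y₀ ≤? k
  ... | yes x₀-y | _       = top-in-window-via x₀ y (vs x₀ y₀ s₀) x₀-y
  ... | no _     | yes x-y₀ = top-in-window-via x y x-y₀ (vs x y sxy)
  ... | no x₀<y  | no x<y₀  = ⊥-elim (ind x₀ y₀ x y s₀ sxy (x₀<y , x<y₀))

  pair-no-wrap : ∀ {x y} → S x y → p x + cdiff N x y ≡ p y
  pair-no-wrap {x} {y} sxy = inc⇒no-wrap x y (vs x y sxy) (proj₁ (top-in-window sxy))

  bottom≤top : ∀ {x y} → S x y → p x ≤ p y
  bottom≤top sxy = subst (_ ≤_) (pair-no-wrap sxy) (m≤m+n _ _)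

  top≤bottom+k : ∀ {x y} → S x y → p y ≤ p x + k
  top≤bottom+k {x} {y} sxy = subst (_≤ p x + k) (pair-no-wrap sxy) (+-monoʳ-≤ (p x) (vs x y sxy))

  left⇒lt-inside : ∀ {x y x′ y′} → S x y → S x′ y′ → p y′ < p x → Lt n k x y′
  left⇒lt-inside {x} {y} {x′} {y′} sxy sx′y′ left = left⇒lt x y′ left (begin-strict
    p x + k           ≤⟨ +-monoˡ-≤ k (≤-trans (bottom≤top sxy) (proj₂ (top-in-window sxy))) ⟩
    k + k + k + k     <⟨ +-monoˡ-< k 3k<N ⟩
    N + k             ≤⟨ +-monoʳ-≤ N (proj₁ (top-in-window sx′y′)) ⟩
    N + p y′          ≡⟨ +-comm N (p y′) ⟩
    p y′ + N          ∎)
    where open ≤-Reasoning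

  BelowTop : Fin N → Fin N → Set
  BelowTop y j = ∃ λ i → S i j × Lt n k i y

  below-top? : ∀ y j → Dec (BelowTop y j)
  below-top? y j = any? (λ i → S? i j ×-dec Lt? i y)

  spread : Fin N → ℕ
  spread y = sup (below-top? y) (λ j → ∣ p y - p j ∣)

  spread-upper : ∀ {i j y} → S i j → Lt n k i y → ∣ p y - p j ∣ ≤ spread y
  spread-upper {i} {j} {y} sij lt = sup-upper (below-top? y) (λ j → ∣ p y - p j ∣) (i , sij , lt)

  spread-< : ∀ y {B} → 0 < B → (∀ i j → S i j → Lt n k i y → ∣ p y - p j ∣ < B) → spread y < B
  spread-< y pos bound = sup-< (below-top? y) (λ j → ∣ p y - p j ∣) pos (λ j (i , sij , lt) → bound i j sij lt)

  spread-increases-right : ∀ {x y x′ y′} → S x y → S x′ y′ → p x + k < p y′ → spread y < spread y′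
  spread-increases-right {x} {y} {x′} {y′} sxy sx′y′ right =
    spread-< y (≤-<-trans z≤n (<-≤-trans (∣-∣-<-farther ≤-refl y<y′) anchor)) bound
    where
    y<y′ : p y < p y′
    y<y′ = ≤-<-trans (top≤bottom+k sxy) right
    anchor : ∣ p y′ - p y ∣ ≤ spread y′
    anchor = spread-upper sxy (right⇒lt x y′ right)
    bound : ∀ i j → S i j → Lt n k i y → ∣ p y - p j ∣ < spread y′
    bound i j sij lt with lt⇒right⊎left i y lt
    ... | inj₁ i-right = <-≤-trans (∣-∣-<-farther j≤y y<y′) (spread-upper sij (right⇒lt i y′ (<-trans i-right y<y′)))
      where
      j≤y : p j ≤ p y
      j≤y = <⇒≤ (≤-<-trans (top≤bottom+k sij) i-right)
    ... | inj₂ i-left with p j <? p y′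
    ...   | yes j<y′ = <-≤-trans (subst (_< ∣ p y′ - p y ∣) (∣-∣-comm (p j) (p y))
                         (∣-∣-<-farther (≤-trans (<⇒≤ i-left) (bottom≤top sij)) j<y′)) anchor
    ...   | no j≮y′  = ⊥-elim (ind x y i j sxy sij (right⇒lt x j (<-≤-trans right (≮⇒≥ j≮y′)) , lt))

  spread-increases-left : ∀ {x y x′ y′} → S x y → S x′ y′ → p y′ < p x → spread y < spread y′
  spread-increases-left {x} {y} {x′} {y′} sxy sx′y′ left =
    spread-< y (≤-<-trans z≤n (<-≤-trans (∣-∣-<-farther′ y′<y ≤-refl) anchor)) bound
    where
    y′<y : p y′ < p y
    y′<y = <-≤-trans left (bottom≤top sxy)
    anchor : ∣ p y′ - p y ∣ ≤ spread y′
    anchor = spread-upper sxy (left⇒lt-inside sxy sx′y′ left)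
    bound : ∀ i j → S i j → Lt n k i y → ∣ p y - p j ∣ < spread y′
    bound i j sij lt with lt⇒right⊎left i y lt
    ... | inj₂ i-left = <-≤-trans (∣-∣-<-farther′ y′<y (≤-trans (<⇒≤ i-left) (bottom≤top sij)))
                          (spread-upper sij (left⇒lt-inside sij sx′y′ (<-trans y′<y i-left)))
    ... | inj₁ i-right with p y′ <? p j
    ...   | yes y′<j = <-≤-trans (subst (_< ∣ p y′ - p y ∣) (∣-∣-comm (p j) (p y))
                         (∣-∣-<-farther′ y′<j (<⇒≤ (≤-<-trans (top≤bottom+k sij) i-right)))) anchor
    ...   | no y′≮j  = ⊥-elim (ind x y i j sxy sij (left⇒lt-inside sxy sij (≤-<-trans (≮⇒≥ y′≮j) left) , lt))

  spread-increases : ∀ x y x′ y′ → S x y → S x′ y′ → Lt n k x y′ → spread y < spread y′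
  spread-increases x y x′ y′ sxy sx′y′ lt with lt⇒right⊎left x y′ lt
  ... | inj₁ right = spread-increases-right sxy sx′y′ right
  ... | inj₂ left  = spread-increases-left sxy sx′y′ left

independent⇒reversible : ∀ {n k} → k + k < n → (S : VertexSet n k) → (∀ i j → Dec (S i j)) →
  IsVertexSet n k S → Independent n k S → Reversible n k S
independent⇒reversible {n} {k} 2k<n S S? vs ind with any? (λ x → any? (λ y → S? x y))
... | no empty = reversible-if-ranked S S? (λ _ → 0) (λ x y _ _ sxy _ _ → ⊥-elim (empty (x , y , sxy)))
... | yes (x₀ , y₀ , s₀) = reversible-if-ranked S S? spread spread-increases
  where
  3k<N : k + k + k < n + k
  3k<N = +-monoˡ-< k 2k<n
  reference : ∃ λ c → cdiff (n + k) c y₀ ≡ k + k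
  reference = cdiff-surjective (n + k) y₀ (k + k) (≤-<-trans (m≤m+n (k + k) k) 3k<N)
  open IndependentSet 3k<N S S? vs ind s₀ (proj₁ reference) (proj₂ reference)

alternating-cycle⇒¬reversible : ∀ {n k} {S : VertexSet n k} {x₁ y₁ x₂ y₂ x₃ y₃} →
  S x₁ y₁ → S x₂ y₂ → S x₃ y₃ → Lt n k x₁ y₂ → Lt n k x₂ y₃ → Lt n k x₃ y₁ → ¬ Reversible n k S
alternating-cycle⇒¬reversible {x₁ = x₁} {y₁} {x₂} {y₂} {x₃} {y₃} s₁ s₂ s₃ lt₁₂ lt₂₃ lt₃₁ (L , reversed) =
  <-irrefl refl (begin-strict
    rank (inj₂ y₁) <⟨ reversed x₁ y₁ s₁ ⟩
    rank (inj₁ x₁) <⟨ rank-mono (inj₁ x₁) (inj₂ y₂) lt₁₂ ⟩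
    rank (inj₂ y₂) <⟨ reversed x₂ y₂ s₂ ⟩
    rank (inj₁ x₂) <⟨ rank-mono (inj₁ x₂) (inj₂ y₃) lt₂₃ ⟩
    rank (inj₂ y₃) <⟨ reversed x₃ y₃ s₃ ⟩
    rank (inj₁ x₃) <⟨ rank-mono (inj₁ x₃) (inj₂ y₁) lt₃₁ ⟩
    rank (inj₂ y₁) ∎)
  where
  open LinExt L
  open ≤-Reasoning

module AlternatingTriangle (n k h : ℕ) (1≤h : 1 ≤ h) (h≤k : h ≤ k) (h<n : h < n) (n≤h+k : n ≤ h + k) where

  N = n + k

  0<N : 0 < N
  0<N = <-≤-trans (≤-<-trans z≤n h<n) (m≤m+n n k)
  h<N : h < N
  h<N = <-≤-trans h<n (m≤m+n n k)
  n<N : n < N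
  n<N = m<m+n n (≤-trans 1≤h h≤k)
  h+k<N : h + k < N
  h+k<N = +-monoˡ-< k h<n

  ι₀ ιₕ ιₙ ιₕ₊ₖ : Fin N
  ι₀   = fromℕ< 0<N
  ιₕ   = fromℕ< h<N
  ιₙ   = fromℕ< n<N
  ιₕ₊ₖ = fromℕ< h+k<N

  S : VertexSet n k
  S i j = (i ≡ ι₀ × j ≡ ιₕ) ⊎ (i ≡ ιₕ × j ≡ ιₕ₊ₖ) ⊎ (i ≡ ιₙ × j ≡ ι₀)

  inc-self : ∀ i → Inc n k i i
  inc-self i = subst (_≤ k) (sym (cdiff-self N i)) z≤n

  inc-0-h : Inc n k ι₀ ιₕ
  inc-0-h = subst (_≤ k) (sym (cdiff-fromℕ<-≤ 0<N h<N z≤n)) h≤k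

  inc-h-h+k : Inc n k ιₕ ιₕ₊ₖ
  inc-h-h+k = ≤-reflexive (trans (cdiff-fromℕ<-≤ h<N h+k<N (m≤m+n h k)) (m+n∸m≡n h k))

  inc-n-0 : Inc n k ιₙ ι₀
  inc-n-0 = ≤-reflexive (trans (cdiff-fromℕ<-> n<N 0<N (≤-<-trans z≤n h<n))
              (trans (cong (_∸ n) (+-identityʳ N)) (m+n∸m≡n n k)))

  inc-n-h+k : Inc n k ιₙ ιₕ₊ₖ
  inc-n-h+k = subst (_≤ k) (sym (cdiff-fromℕ<-≤ n<N h+k<N n≤h+k))
    (subst (h + k ∸ n ≤_) (m+n∸m≡n n k) (∸-monoˡ-≤ n (+-monoˡ-≤ k (<⇒≤ h<n))))

  lt-0-h+k : Lt n k ι₀ ιₕ₊ₖ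
  lt-0-h+k inc = <⇒≱ (+-monoˡ-≤ k 1≤h) (subst (_≤ k) (cdiff-fromℕ<-≤ 0<N h+k<N z≤n) inc)

  lt-h-0 : Lt n k ιₕ ι₀
  lt-h-0 inc = <⇒≱ (+-monoˡ-< k (m<n⇒0<n∸m h<n)) (subst (_≤ k) cdiff≡ inc)
    where
    cdiff≡ : cdiff N ιₕ ι₀ ≡ (n ∸ h) + k
    cdiff≡ = trans (cdiff-fromℕ<-> h<N 0<N 1≤h)
               (trans (cong (_∸ h) (+-identityʳ N)) (+-∸-comm k (<⇒≤ h<n)))

  lt-n-h : Lt n k ιₙ ιₕ
  lt-n-h inc = <⇒≱ (m<m+n k 1≤h) (subst (_≤ k) cdiff≡ inc)
    where
    cdiff≡ : cdiff N ιₙ ιₕ ≡ k + h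
    cdiff≡ = trans (cdiff-fromℕ<-> n<N h<N h<n)
               (trans (cong (_∸ n) (+-assoc n k h)) (m+n∸m≡n n (k + h)))

  vertex-set : IsVertexSet n k S
  vertex-set _ _ (inj₁ (refl , refl))        = inc-0-h
  vertex-set _ _ (inj₂ (inj₁ (refl , refl))) = inc-h-h+k
  vertex-set _ _ (inj₂ (inj₂ (refl , refl))) = inc-n-0

  independent : Independent n k S
  independent _ _ _ _ (inj₁ (refl , refl))        (inj₁ (refl , refl))        (lt , _) = lt inc-0-h
  independent _ _ _ _ (inj₁ (refl , refl))        (inj₂ (inj₁ (refl , refl))) (_ , lt) = lt (inc-self ιₕ)
  independent _ _ _ _ (inj₁ (refl , refl))        (inj₂ (inj₂ (refl , refl))) (lt , _) = lt (inc-self ι₀)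
  independent _ _ _ _ (inj₂ (inj₁ (refl , refl))) (inj₁ (refl , refl))        (lt , _) = lt (inc-self ιₕ)
  independent _ _ _ _ (inj₂ (inj₁ (refl , refl))) (inj₂ (inj₁ (refl , refl))) (lt , _) = lt inc-h-h+k
  independent _ _ _ _ (inj₂ (inj₁ (refl , refl))) (inj₂ (inj₂ (refl , refl))) (_ , lt) = lt inc-n-h+k
  independent _ _ _ _ (inj₂ (inj₂ (refl , refl))) (inj₁ (refl , refl))        (_ , lt) = lt (inc-self ι₀)
  independent _ _ _ _ (inj₂ (inj₂ (refl , refl))) (inj₂ (inj₁ (refl , refl))) (lt , _) = lt inc-n-h+k
  independent _ _ _ _ (inj₂ (inj₂ (refl , refl))) (inj₂ (inj₂ (refl , refl))) (lt , _) = lt inc-n-0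

  irreversible : ¬ Reversible n k S
  irreversible = alternating-cycle⇒¬reversible
    (inj₁ (refl , refl)) (inj₂ (inj₁ (refl , refl))) (inj₂ (inj₂ (refl , refl)))
    lt-0-h+k lt-h-0 lt-n-h

triangle-offset : ∀ {n k} → 3 ≤ n → n ≤ 2 * k → ∃ λ h → 1 ≤ h × h ≤ k × h < n × n ≤ h + k
triangle-offset {n} {zero} 3≤n n≤0 = ⊥-elim (<⇒≱ (≤-trans (s≤s z≤n) 3≤n) n≤0)
triangle-offset {n} {suc k} 3≤n n≤2k with n ≤? suc (suc k)
... | yes n≤1+k = 1 , ≤-refl , s≤s z≤n , <-≤-trans (s≤s (s≤s z≤n)) 3≤n , n≤1+k
... | no n≰1+k = n ∸ suc k , m<n⇒0<n∸m k<n , n-k≤k , ∸-monoʳ-< (s≤s z≤n) (<⇒≤ k<n) ,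
                 ≤-reflexive (sym (m∸n+n≡m (<⇒≤ k<n)))
  where
  k<n : suc k < n
  k<n = <-trans (n<1+n (suc k)) (≰⇒> n≰1+k)
  n-k≤k : n ∸ suc k ≤ suc k
  n-k≤k = subst (n ∸ suc k ≤_) (m+n∸n≡m (suc k) (suc k))
    (∸-monoˡ-≤ (suc k) (subst (n ≤_) (cong (suc k +_) (+-identityʳ (suc k))) n≤2k))

lemma1p4 : (n k : ℕ) → 3 ≤ n →
    (Σ (VertexSet n k) (λ S → IsVertexSet n k S × Independent n k S × ¬ Reversible n k S))
      ⇔ (n ≤ 2 * k)
lemma1p4 n k 3≤n = mk⇔ necessary sufficient
  where
  necessary : Σ (VertexSet n k) (λ S → IsVertexSet n k S × Independent n k S × ¬ Reversible n k S) →
    n ≤ 2 * k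
  necessary (S , vs , ind , irreversible) with n ≤? 2 * k
  ... | yes n≤2k = n≤2k
  -- Irreversibility is a negative hypothesis, so S may be assumed decidable.
  ... | no n≰2k = ⊥-elim (¬¬-decidable₂ S (λ S? → irreversible (independent⇒reversible 2k<n S S? vs ind)))
    where
    2k<n : k + k < n
    2k<n = subst (_< n) (cong (k +_) (+-identityʳ k)) (≰⇒> n≰2k)

  sufficient : n ≤ 2 * k →
    Σ (VertexSet n k) (λ S → IsVertexSet n k S × Independent n k S × ¬ Reversible n k S)
  sufficient n≤2k with triangle-offset 3≤n n≤2k
  ... | h , 1≤h , h≤k , h<n , n≤h+k = S , vertex-set , independent , irreversible
    where open AlternatingTriangle n k h 1≤h h≤k h<n n≤h+k
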